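{- Let $D$ be a digraph having a spanning subdigraph $H$ such that $H$ is strongly connected and there is a partition $V(H)=V_1\cup V_2$ with $V_1\cap V_2=\emptyset$ for which $H[V_1]$ is strongly connected and bipartite and $V_2$ is an independent set of vertices of $H$. Then $\overrightarrow{pc}(D)\le 2$.
   Context: All digraphs are finite, loopless, without parallel arcs (opposite arcs are allowed). $H[V_1]$ is the subdigraph of $H$ induced by $V_1$. A digraph is bipartite if its vertex set can be partitioned into two independent sets; a set is independent if no arc has both ends in it. A digraph is strongly connected if for every ordered pair $(u,v)$ of vertices there is a directed $uv$-path. A directed path in an arc-coloured digraph is properly coloured if no two consecutive arcs on it have the same colour. An arc-colouring of $D$ makes $D$ properly connected if for every ordered pair $(u,v)$ of distinct vertices there is a properly coloured directed $uv$-path; $\overrightarrow{pc}(D)$ is the minimum number of colours in such an arc-colouring. -}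

module Defs where

open import Data.Nat using (ℕ; suc)
open import Data.Fin using (Fin)
open import Data.Bool using (Bool; true; false)
open import Data.List using (List; []; _∷_)
open import Data.List.Relation.Unary.Unique.Propositional using (Unique)
open import Data.Product using (Σ; _×_; _,_; ∃-syntax)
open import Relation.Binary.PropositionalEquality using (_≡_; _≢_)
open import Relation.Nullary using (¬_)
open import Data.Unit using (⊤)

-- A digraph on vertex set Fin n: an arc relation, loopless.
-- (A relation has no parallel arcs; opposite arcs u→v, v→u are allowed.)
record Digraph (n : ℕ) : Set₁ where
  field
    Arc      : Fin n → Fin n → Set
    loopless : ∀ v → ¬ Arc v v
open Digraph public

data Walk {n : ℕ} (D : Digraph n) : Fin n → Fin n → Set where
  stop : ∀ {u} → Walk D u u
  step : ∀ {u v w} → Arc D u v → Walk D v w → Walk D u w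

vertices : ∀ {n} {D : Digraph n} {u v} → Walk D u v → List (Fin n)
vertices {u = u} stop = u ∷ []
vertices {u = u} (step _ p) = u ∷ vertices p

IsPath : ∀ {n} {D : Digraph n} {u v} → Walk D u v → Set
IsPath p = Unique (vertices p)

WithinSet : ∀ {n} {D : Digraph n} → (Fin n → Bool) → ∀ {u v} → Walk D u v → Set
WithinSet S {u = u} stop = S u ≡ true
WithinSet S {u = u} (step _ p) = (S u ≡ true) × WithinSet S p

SpanningSub : ∀ {n} → Digraph n → Digraph n → Set
SpanningSub H D = ∀ u v → Arc H u v → Arc D u v

StronglyConnected : ∀ {n} → Digraph n → Set
StronglyConnected D = ∀ u v → Σ (Walk D u v) IsPath

-- H[S] strongly connected: for all u,v in S there is a directed uv-path in H
-- using only vertices of S (i.e. a path of the induced subdigraph H[S]).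
InducedStronglyConnected : ∀ {n} → Digraph n → (Fin n → Bool) → Set
InducedStronglyConnected H S =
  ∀ u v → S u ≡ true → S v ≡ true →
    Σ (Walk H u v) (λ p → IsPath p × WithinSet S p)

Independent : ∀ {n} → Digraph n → (Fin n → Bool) → Set
Independent H S = ∀ u v → S u ≡ true → S v ≡ true → ¬ Arc H u v

InducedBipartite : ∀ {n : ℕ} → Digraph n → (Fin n → Bool) → Set
InducedBipartite {n} H S =
  Σ (Fin n → Bool) λ side → (∀ u v → S u ≡ true → S v ≡ true → side u ≡ side v → ¬ Arc H u v)

compl : ∀ {n} → (Fin n → Bool) → (Fin n → Bool)
compl S v with S v
... | true = false
... | false = true

-- Arc-colourings with k colours (only values on arcs matter).
Colouring : ℕ → ℕ → Set
Colouring n k = Fin n → Fin n → Fin k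

ProperlyColoured : ∀ {n k} {D : Digraph n} {u v} → Colouring n k → Walk D u v → Set
ProperlyColoured c stop = ⊤
ProperlyColoured c (step _ stop) = ⊤
ProperlyColoured c (step {u} {v} _ (step {v = x} a p)) =
  (c u v ≢ c v x) × ProperlyColoured c (step a p)

ProperlyConnects : ∀ {n k} → Digraph n → Colouring n k → Set
ProperlyConnects D c =
  ∀ u v → u ≢ v → Σ (Walk D u v) (λ p → IsPath p × ProperlyColoured c p)

pc≤ : ∀ {n} → Digraph n → ℕ → Set
pc≤ D k = Σ (Colouring _ k) (ProperlyConnects D)

-- Colour an arc leaving V₁ by the side of its tail and an arc entering V₁ from V₂ by the side opposite
-- to its head. Since H[V₁] is bipartite, consecutive arcs with tails in V₁ get different colours, so
-- every path of H whose internal vertices lie in V₁ is properly coloured, also after prepending an arc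
-- from V₂. As V₂ is independent, every vertex of V₂ has its out- and in-neighbours in V₁, and strong
-- connectivity of H[V₁] connects any two such neighbours inside V₁ (strong connectivity of H is only
-- needed to provide these neighbours).
module Submission where

open import Defs
open import Data.Nat using (ℕ)
open import Data.Fin using (Fin)
open import Data.Fin.Properties using (2↔Bool)
open import Data.Bool using (Bool; true; false; not; if_then_else_)
open import Data.Bool.Properties using (not-¬)
open import Data.List using ([]; _∷_; _∷ʳ_)
open import Data.List.Relation.Unary.All as All using (All; []; _∷_)
open import Data.List.Relation.Unary.AllPairs using ([]; _∷_)
open import Data.List.Relation.Unary.Unique.Propositional using (Unique)
import Data.List.Relation.Unary.AllPairs.Properties as AllPairs
open import Data.Product using (Σ; ∃; _×_; _,_; proj₁)
open import Data.Unit using (⊤; tt)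
open import Data.Empty using (⊥-elim)
open import Function.Bundles using (_↔_; Inverse; Injection)
open import Function.Properties.Inverse using (↔-sym; ↔⇒↣)
open import Relation.Binary.PropositionalEquality
  using (_≡_; _≢_; refl; sym; trans; cong; subst; ≢-sym)
open import Relation.Nullary using (¬_)

module _ {n : ℕ} {D : Digraph n} where

  _▷_ : ∀ {u w v} → Walk D u w → Arc D w v → Walk D u v
  stop     ▷ e = step e stop
  step a p ▷ e = step a (p ▷ e)

  vertices-▷ : ∀ {u w v} (p : Walk D u w) (e : Arc D w v) → vertices (p ▷ e) ≡ vertices p ∷ʳ v
  vertices-▷ stop       e = refl
  vertices-▷ (step a p) e = cong (_ ∷_) (vertices-▷ p e)

  ▷-isPath : ∀ {u w v} (p : Walk D u w) (e : Arc D w v) →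
             IsPath p → All (_≢ v) (vertices p) → IsPath (p ▷ e)
  ▷-isPath p e p-path v-new rewrite vertices-▷ p e =
    AllPairs.++⁺ p-path ([] ∷ []) (All.map (_∷ []) v-new)

  out-neighbour : ∀ {u v} → Walk D u v → u ≢ v → ∃ (Arc D u)
  out-neighbour stop       u≢v = ⊥-elim (u≢v refl)
  out-neighbour (step e _) _   = _ , e

  in-neighbour : ∀ {u v} → Walk D u v → u ≢ v → ∃ λ b → Arc D b v
  in-neighbour stop       u≢v = ⊥-elim (u≢v refl)
  in-neighbour (step e p) _   = last-arc e p
    where
    last-arc : ∀ {u w v} → Arc D u w → Walk D w v → ∃ λ b → Arc D b v
    last-arc e stop        = _ , e
    last-arc _ (step e' p) = last-arc e' p

  TailsWithin : (Fin n → Bool) → ∀ {u v} → Walk D u v → Set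
  TailsWithin S stop           = ⊤
  TailsWithin S (step {u} _ p) = S u ≡ true × TailsWithin S p

  within⇒tailsWithin : ∀ {S u v} (p : Walk D u v) → WithinSet S p → TailsWithin S p
  within⇒tailsWithin stop       _        = tt
  within⇒tailsWithin (step _ p) (Su , w) = Su , within⇒tailsWithin p w

  ▷-tailsWithin : ∀ {S u w v} (p : Walk D u w) (e : Arc D w v) → WithinSet S p → TailsWithin S (p ▷ e)
  ▷-tailsWithin stop       e Sw       = Sw , tt
  ▷-tailsWithin (step _ p) e (Su , w) = Su , ▷-tailsWithin p e w

  within⇒All : ∀ {S u v} (p : Walk D u v) → WithinSet S p → All (λ x → S x ≡ true) (vertices p)
  within⇒All stop       Su       = Su ∷ []
  within⇒All (step _ p) (Su , w) = Su ∷ within⇒All p w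

separates : ∀ {n} {S : Fin n → Bool} {x y} → S x ≡ false → S y ≡ true → x ≢ y
separates {S = S} Sx Sy x≡y = not-¬ refl (trans (sym Sx) (trans (cong S x≡y) Sy))

tailsWithin-avoids : ∀ {n} {D : Digraph n} {S x u v} (p : Walk D u v) →
                     TailsWithin S p → S x ≡ false → x ≢ v → All (x ≢_) (vertices p)
tailsWithin-avoids stop       _        _  x≢v = x≢v ∷ []
tailsWithin-avoids (step _ p) (Su , t) Sx x≢v = separates Sx Su ∷ tailsWithin-avoids p t Sx x≢v

compl-false : ∀ {n} (S : Fin n → Bool) {x} → S x ≡ false → compl S x ≡ true
compl-false S {x} Sx with S x
compl-false S () | true
compl-false S _  | false = refl

module ComplementIndependent {n : ℕ} (H : Digraph n) (S : Fin n → Bool) (indep : Independent H (compl S)) where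

  head-in : ∀ {x y} → S x ≡ false → Arc H x y → S y ≡ true
  head-in {x} {y} Sx e with S y in Sy
  ... | true  = refl
  ... | false = ⊥-elim (indep x y (compl-false S Sx) (compl-false S Sy) e)

  tail-in : ∀ {x y} → S y ≡ false → Arc H x y → S x ≡ true
  tail-in {x} {y} Sy e with S x in Sx
  ... | true  = refl
  ... | false = ⊥-elim (indep x y (compl-false S Sx) (compl-false S Sy) e)

module _ {n : ℕ} {H D : Digraph n} (H⊆D : SpanningSub H D) where

  lift : ∀ {u v} → Walk H u v → Walk D u v
  lift stop       = stop
  lift (step e p) = step (H⊆D _ _ e) (lift p)

  vertices-lift : ∀ {u v} (p : Walk H u v) → vertices (lift p) ≡ vertices p
  vertices-lift stop       = refl
  vertices-lift (step e p) = cong (_ ∷_) (vertices-lift p)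

  lift-properlyColoured : ∀ {k} {c : Colouring n k} {u v} (p : Walk H u v) →
                          ProperlyColoured c p → ProperlyColoured c (lift p)
  lift-properlyColoured stop                 _         = tt
  lift-properlyColoured (step e stop)        _         = tt
  lift-properlyColoured (step e (step e' p)) (c≢ , pc) = c≢ , lift-properlyColoured (step e' p) pc

  lift-properPath : ∀ {k} {c : Colouring n k} {u v} →
                    Σ (Walk H u v) (λ p → IsPath p × ProperlyColoured c p) →
                    Σ (Walk D u v) (λ p → IsPath p × ProperlyColoured c p)
  lift-properPath (p , p-path , pc) =
    lift p , subst Unique (sym (vertices-lift p)) p-path , lift-properlyColoured p pc

Bool↔2 : Bool ↔ Fin 2
Bool↔2 = ↔-sym 2↔Bool

module BipartiteColouring {n : ℕ} (H : Digraph n) (V₁ side : Fin n → Bool)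
  (bip : ∀ u v → V₁ u ≡ true → V₁ v ≡ true → side u ≡ side v → ¬ Arc H u v) where

  open Inverse Bool↔2 using () renaming (to to toFin)
  open Injection (↔⇒↣ Bool↔2) using () renaming (injective to toFin-injective)

  colour : Colouring n 2
  colour x y = toFin (if V₁ x then side x else not (side y))

  colour-from-V₁ : ∀ {x} y → V₁ x ≡ true → colour x y ≡ toFin (side x)
  colour-from-V₁ y V₁x rewrite V₁x = refl

  colour-from-V₂ : ∀ {x} y → V₁ x ≡ false → colour x y ≡ toFin (not (side y))
  colour-from-V₂ y V₁x rewrite V₁x = refl

  tailsWithin⇒properlyColoured : ∀ {u v} (p : Walk H u v) → TailsWithin V₁ p → ProperlyColoured colour p
  tailsWithin⇒properlyColoured stop          _ = tt
  tailsWithin⇒properlyColoured (step _ stop) _ = tt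
  tailsWithin⇒properlyColoured (step {u} {v} e (step {v = x} e' p)) (V₁u , V₁v , t) =
    (λ same → bip u v V₁u V₁v
       (toFin-injective (trans (sym (colour-from-V₁ v V₁u)) (trans same (colour-from-V₁ x V₁v)))) e)
    , tailsWithin⇒properlyColoured (step e' p) (V₁v , t)

  enter-properlyColoured : ∀ {u a v} (e : Arc H u a) (p : Walk H a v) → V₁ u ≡ false →
                           TailsWithin V₁ p → ProperlyColoured colour p → ProperlyColoured colour (step e p)
  enter-properlyColoured e stop _ _ _ = tt
  enter-properlyColoured {a = a} e (step {v = x} _ _) V₂u (V₁a , _) pc =
    (λ same → not-¬ refl
       (sym (toFin-injective (trans (sym (colour-from-V₂ a V₂u)) (trans same (colour-from-V₁ x V₁a))))))
    , pc

corollary2 : (n : ℕ) (D H : Digraph n) (V₁ : Fin n → Bool) →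
    SpanningSub H D → StronglyConnected H →
    InducedStronglyConnected H V₁ → InducedBipartite H V₁ →
    Independent H (compl V₁) →
    pc≤ D 2
corollary2 n D H V₁ H⊆D H-strong V₁-strong (side , bip) V₂-indep =
  colour , λ u v u≢v → lift-properPath H⊆D (properPath u v u≢v)
  where
  open BipartiteColouring H V₁ side bip
  open ComplementIndependent H V₁ V₂-indep

  pathFromV₁ : ∀ {u} v → V₁ u ≡ true → Σ (Walk H u v) (λ p → IsPath p × TailsWithin V₁ p)
  pathFromV₁ {u} v V₁u with V₁ v in V₁v
  ... | true  = let (p , p-path , w) = V₁-strong u v V₁u V₁v in p , p-path , within⇒tailsWithin p w
  ... | false =
    let (b , e) = in-neighbour (proj₁ (H-strong u v)) (≢-sym (separates V₁v V₁u))
        (p , p-path , w) = V₁-strong u b V₁u (tail-in V₁v e)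
    in p ▷ e , ▷-isPath p e p-path (All.map (λ V₁x → ≢-sym (separates V₁v V₁x)) (within⇒All p w))
     , ▷-tailsWithin p e w

  properPath : ∀ u v → u ≢ v → Σ (Walk H u v) (λ p → IsPath p × ProperlyColoured colour p)
  properPath u v u≢v with V₁ u in V₁u
  ... | true  = let (p , p-path , t) = pathFromV₁ v V₁u in p , p-path , tailsWithin⇒properlyColoured p t
  ... | false =
    let (a , e) = out-neighbour (proj₁ (H-strong u v)) u≢v
        (p , p-path , t) = pathFromV₁ v (head-in V₁u e)
    in step e p , tailsWithin-avoids p t V₁u u≢v ∷ p-path
     , enter-properlyColoured e p V₁u t (tailsWithin⇒properlyColoured p t)
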